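{- Let $G=(V,E)$ be an undirected graph (parallel edges allowed) with terminals $s,t$ such that every vertex and every edge of $G$ lies on some $s$-$t$ path. If $T\subseteq E$ is a tracking edge set for $(G,s,t)$, then every cycle of $G$ contains an edge belonging to $T$.
   Context: An $s$-$t$ path is a simple path from $s$ to $t$ (specified by its sequence of edges). A set $T\subseteq E$ is a tracking edge set if for any two distinct $s$-$t$ paths $P_1,P_2$, the sequence of edges of $T\cap E(P_1)$ in the order along $P_1$ differs from the sequence of edges of $T\cap E(P_2)$ in the order along $P_2$. -}

module Defs where

open import Data.Nat using (ℕ)
open import Data.Fin using (Fin)
open import Data.Fin.Subset using (Subset) renaming (_∈_ to _∈ₛ_)
open import Data.Fin.Subset.Properties using (_∈?_)
open import Data.List using (List; []; _∷_; filter)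
open import Data.List.Membership.Propositional using (_∈_)
open import Data.List.Relation.Unary.Unique.Propositional using (Unique)
open import Data.Product using (_×_; _,_; ∃; ∃-syntax)
open import Data.Sum using (_⊎_)
open import Relation.Binary.PropositionalEquality using (_≡_; _≢_)

-- A finite undirected multigraph: vertices Fin nV, edges Fin nE,
-- each edge has an (unordered) pair of endpoints given by `ends`.
record Graph : Set where
  field
    nV   : ℕ
    nE   : ℕ
    ends : Fin nE → Fin nV × Fin nV

module _ (G : Graph) where
  open Graph G

  Vertex : Set
  Vertex = Fin nV

  Edge : Set
  Edge = Fin nE

  Joins : Edge → Vertex → Vertex → Set
  Joins e u v = (ends e ≡ (u , v)) ⊎ (ends e ≡ (v , u))

  -- Walk u w vs es : a walk from u to w with vertex sequence vs and
  -- edge sequence es (vs has one more entry than es).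
  data Walk : Vertex → Vertex → List Vertex → List Edge → Set where
    nil  : ∀ {u} → Walk u u (u ∷ []) []
    step : ∀ {u v w vs es} (e : Edge) → Joins e u v →
           Walk v w vs es → Walk u w (u ∷ vs) (e ∷ es)

  IsPathVia : Vertex → Vertex → List Vertex → List Edge → Set
  IsPathVia s t vs es = Walk s t vs es × Unique vs

  IsPath : Vertex → Vertex → List Edge → Set
  IsPath s t es = ∃[ vs ] IsPathVia s t vs es

  -- a cycle: a closed walk u = v0, v1, ..., vk = u with k ≥ 1, whose
  -- vertices v1..vk are pairwise distinct and whose edges are pairwise distinct
  -- (a loop is a cycle of length 1, two parallel edges form a cycle of length 2)
  IsCycle : List Edge → Set
  IsCycle es = ∃[ u ] ∃[ vs ] ∃[ e ] ∃[ es' ]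
                 (es ≡ e ∷ es') × Walk u u (u ∷ vs) es × Unique vs × Unique es

  trace : Subset nE → List Edge → List Edge
  trace T es = filter (_∈? T) es

  IsTrackingSet : Vertex → Vertex → Subset nE → Set
  IsTrackingSet s t T = ∀ P₁ P₂ → IsPath s t P₁ → IsPath s t P₂ →
                         P₁ ≢ P₂ → trace T P₁ ≢ trace T P₂

  AllOnPaths : Vertex → Vertex → Set
  AllOnPaths s t =
    (∀ (v : Vertex) → ∃[ vs ] ∃[ es ] IsPathVia s t vs es × v ∈ vs) ×
    (∀ (e : Edge) → ∃[ es ] IsPath s t es × e ∈ es)

-- Suppose a cycle C avoids T. Take an edge e of C and an s-t path P through e.
-- Both ends of e lie on C, so P meets C in at least two vertices; let x be the
-- first and y the last of them along P. Replacing the x-y segment of P by either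
-- of the two x-y arcs of C gives two distinct s-t paths, which are simple because
-- P only touches C at x before and at y after the segment. Neither arc carries an
-- edge of T, so both paths have the same trace, contradicting tracking.
module Submission where

open import Defs
open import Data.Fin.Subset using (Subset) renaming (_∈_ to _∈ₛ_)
open import Data.List.Membership.Propositional using (_∈_)
open import Data.List using (List)
open import Data.Product using (_×_; ∃-syntax)

open import Data.Empty using (⊥; ⊥-elim)
open import Data.Fin using () renaming (_≟_ to _≟ᶠ_)
open import Data.Fin.Subset.Properties using (_∈?_)
open import Data.List using ([]; _∷_; _++_; reverse)
open import Data.List.Membership.Propositional using (_∉_; find; lose)
open import Data.List.Membership.Propositional.Properties using (∈-++⁺ˡ; ∈-++⁺ʳ; ∈-++⁻)
import Data.List.Membership.DecPropositional as DecMembership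
open import Data.List.Properties using (unfold-reverse; filter-++; filter-none; ++-cancelˡ; ++-cancelʳ)
open import Data.List.Relation.Binary.Disjoint.Propositional using (Disjoint)
open import Data.List.Relation.Binary.Permutation.Propositional using (_↭_; ↭-refl; ↭-sym; ↭-trans; prep; ↭⇒↭ₛ)
open import Data.List.Relation.Binary.Permutation.Propositional.Properties using (++-comm; ↭-reverse; ∈-resp-↭; ∷↭∷ʳ)
import Data.List.Relation.Binary.Permutation.Setoid.Properties as Setoid↭
open import Data.List.Relation.Binary.Subset.Propositional using (_⊆_)
open import Data.List.Relation.Unary.All using (All; []; _∷_; lookup; tabulate)
open import Data.List.Relation.Unary.All.Properties using (++⁻ˡ; ++⁻ʳ; ¬Any⇒All¬)
open import Data.List.Relation.Unary.Any using (Any; here; there; any?)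
open import Data.List.Relation.Unary.Unique.Propositional using (Unique; []; _∷_)
open import Data.List.Relation.Unary.Unique.Propositional.Properties using (++⁺; Unique[x∷xs]⇒x∉xs)
open import Data.Product using (Σ-syntax; _,_; proj₁; proj₂)
open import Data.Sum using (_⊎_; inj₁; inj₂)
open import Function using (_∘_)
open import Level using (0ℓ)
open import Relation.Binary.PropositionalEquality
open import Relation.Nullary using (¬_; yes; no)
open import Relation.Unary using (Pred; Decidable; ∁)

module _ {A : Set} where

  Unique-∷ : ∀ {x : A} {xs} → x ∉ xs → Unique xs → Unique (x ∷ xs)
  Unique-∷ {xs = xs} x∉xs u = ¬Any⇒All¬ xs x∉xs ∷ u

  Unique-++⁻ : ∀ (xs : List A) {ys} → Unique (xs ++ ys) → Unique xs × Unique ys × Disjoint xs ys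
  Unique-++⁻ []       u          = [] , u , λ { (() , _) }
  Unique-++⁻ (x ∷ xs) (x∉ ∷ u) with Unique-++⁻ xs u
  ... | uxs , uys , xs#ys = ++⁻ˡ xs x∉ ∷ uxs , uys , λ where
    (here refl , x∈ys) → lookup (++⁻ʳ xs x∉) x∈ys refl
    (there v∈xs , v∈ys) → xs#ys (v∈xs , v∈ys)

  Unique-resp-↭ : ∀ {xs ys : List A} → xs ↭ ys → Unique xs → Unique ys
  Unique-resp-↭ xs↭ys = Setoid↭.Unique-resp-↭ (setoid A) (↭⇒↭ₛ xs↭ys)

  distinct-witnesses⇒Any-suffix : ∀ {S : Pred A 0ℓ} xs {ys} {x p q} →
    All (λ v → S v → v ≡ x) xs → p ∈ xs ++ ys → q ∈ xs ++ ys → S p → S q → p ≢ q →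
    Any S ys
  distinct-witnesses⇒Any-suffix xs only-x p∈ q∈ Sp Sq p≢q with ∈-++⁻ xs p∈ | ∈-++⁻ xs q∈
  ... | inj₂ p∈ys | _         = lose p∈ys Sp
  ... | inj₁ _    | inj₂ q∈ys = lose q∈ys Sq
  ... | inj₁ p∈xs | inj₁ q∈xs =
    ⊥-elim (p≢q (trans (lookup only-x p∈xs Sp) (sym (lookup only-x q∈xs Sq))))

module _ (G : Graph) where
  open Graph G using (nE)

  private variable
    a b c s t u v w x y p q : Vertex G
    ws ws′ vs cs : List (Vertex G)
    e : Edge G
    es es′ ces : List (Edge G)

  Joins-sym : Joins G e u v → Joins G e v u
  Joins-sym (inj₁ ends≡) = inj₂ ends≡
  Joins-sym (inj₂ ends≡) = inj₁ ends≡

  Joins-endpoint : Joins G e p q → Joins G e u v → p ≡ u ⊎ p ≡ v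
  Joins-endpoint (inj₁ pq) (inj₁ uv) = inj₁ (cong proj₁ (trans (sym pq) uv))
  Joins-endpoint (inj₁ pq) (inj₂ vu) = inj₂ (cong proj₁ (trans (sym pq) vu))
  Joins-endpoint (inj₂ qp) (inj₁ uv) = inj₂ (cong proj₂ (trans (sym qp) uv))
  Joins-endpoint (inj₂ qp) (inj₂ vu) = inj₁ (cong proj₂ (trans (sym qp) vu))

  Joins-endpoint∈ : Joins G e u v → u ∈ vs → v ∈ vs → Joins G e p q → p ∈ vs
  Joins-endpoint∈ joins-uv u∈ v∈ joins-pq with Joins-endpoint joins-pq joins-uv
  ... | inj₁ refl = u∈
  ... | inj₂ refl = v∈

  -- Unlike Walk, the vertex list omits the start vertex, so that walks
  -- concatenate by _++_ on both lists.
  data Walk′ : Vertex G → Vertex G → List (Vertex G) → List (Edge G) → Set where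
    nil  : Walk′ u u [] []
    step : (e : Edge G) → Joins G e u v → Walk′ v w ws es → Walk′ u w (v ∷ ws) (e ∷ es)

  walk⇒walk′ : Walk G a b vs es → ∃[ ws ] vs ≡ a ∷ ws × Walk′ a b ws es
  walk⇒walk′ nil = [] , refl , nil
  walk⇒walk′ (step e j w) with walk⇒walk′ w
  ... | _ , refl , w′ = _ , refl , step e j w′

  walk′⇒walk : Walk′ a b ws es → Walk G a b (a ∷ ws) es
  walk′⇒walk nil          = nil
  walk′⇒walk (step e j w) = step e j (walk′⇒walk w)

  _++ʷ_ : Walk′ a b ws es → Walk′ b c ws′ es′ → Walk′ a c (ws ++ ws′) (es ++ es′)
  nil        ++ʷ w′ = w′
  step e j w ++ʷ w′ = step e j (w ++ʷ w′)

  reverse-walk′ : Walk′ a b ws es → ∃[ ws′ ] b ∷ ws′ ↭ a ∷ ws × Walk′ b a ws′ (reverse es)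
  reverse-walk′ nil = [] , ↭-refl , nil
  reverse-walk′ {a = a} (step {es = es} e j w) with reverse-walk′ w
  ... | ws′ , b∷ws′↭ , w′ =
    _ , ↭-trans (↭-sym (∷↭∷ʳ a (_ ∷ ws′))) (prep a b∷ws′↭) ,
    subst (Walk′ _ _ _) (sym (unfold-reverse e es)) (w′ ++ʷ step e (Joins-sym j) nil)

  end∈ : Walk′ a b ws es → b ∈ a ∷ ws
  end∈ nil          = here refl
  end∈ (step e j w) = there (end∈ w)

  end∈tail : Walk′ a b ws es → a ≢ b → b ∈ ws
  end∈tail w a≢b with end∈ w
  ... | here b≡a  = ⊥-elim (a≢b (sym b≡a))
  ... | there b∈ = b∈

  edge-exists : Walk′ a b ws es → a ≢ b → ∃[ g ] g ∈ es
  edge-exists nil          a≢a = ⊥-elim (a≢a refl)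
  edge-exists (step e _ _) _   = e , here refl

  simple-walk-edge-ends : Walk′ a b ws es → Unique (a ∷ ws) → e ∈ es →
    ∃[ p ] ∃[ q ] Joins G e p q × p ∈ a ∷ ws × q ∈ a ∷ ws × p ≢ q
  simple-walk-edge-ends (step e j w) (a∉ ∷ _) (here refl) =
    _ , _ , j , here refl , there (here refl) , lookup a∉ (here refl)
  simple-walk-edge-ends (step e j w) (_ ∷ simple) (there e∈) with simple-walk-edge-ends w simple e∈
  ... | p , q , jpq , p∈ , q∈ , p≢q = p , q , jpq , there p∈ , there q∈ , p≢q

  record Split (a b x : Vertex G) (ws : List (Vertex G)) (es : List (Edge G)) : Set where
    constructor split
    field
      {ws₁ ws₂} : List (Vertex G)
      {es₁ es₂} : List (Edge G)
      prefix    : Walk′ a x ws₁ es₁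
      suffix    : Walk′ x b ws₂ es₂
      vertices≡ : ws ≡ ws₁ ++ ws₂
      edges≡    : es ≡ es₁ ++ es₂

  split-at : Walk′ a b ws es → x ∈ ws → Split a b x ws es
  split-at (step e j w) (here refl) = split (step e j nil) w refl refl
  split-at (step e j w) (there x∈) with split-at w x∈
  ... | split w₁ w₂ refl refl = split (step e j w₁) w₂ refl refl

  module _ {S : Pred (Vertex G) 0ℓ} (S? : Decidable S) where

    split-at-first : Walk′ a b ws es → Any S (a ∷ ws) →
      ∃[ x ] S x × Σ[ σ ∈ Split a b x ws es ] All (λ v → S v → v ≡ x) (a ∷ Split.ws₁ σ)
    split-at-first {a = a} w _ with S? a
    ... | yes Sa = a , Sa , split nil w refl refl , (λ _ → refl) ∷ []
    split-at-first w (here Sa) | no ¬Sa = ⊥-elim (¬Sa Sa)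
    split-at-first (step e j w) (there S-later) | no ¬Sa with split-at-first w S-later
    ... | x , Sx , split w₁ w₂ refl refl , only-x =
      x , Sx , split (step e j w₁) w₂ refl refl , (λ Sa → ⊥-elim (¬Sa Sa)) ∷ only-x

    split-at-last : Walk′ a b ws es → Any S ws →
      ∃[ y ] S y × Σ[ σ ∈ Split a b y ws es ] y ∈ Split.ws₁ σ × All (∁ S) (Split.ws₂ σ)
    split-at-last (step {ws = ws} e j w) S-here-or-later with any? S? ws
    ... | yes S-later with split-at-last w S-later
    ...   | y , Sy , split w₁ w₂ refl refl , y∈ , none-after =
      y , Sy , split (step e j w₁) w₂ refl refl , there y∈ , none-after
    split-at-last (step {ws = ws} e j w) (here Sv) | no ¬S-later =
      _ , Sv , split (step e j nil) w refl refl , here refl , ¬Any⇒All¬ ws ¬S-later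
    split-at-last (step e j w) (there S-later) | no ¬S-later = ⊥-elim (¬S-later S-later)

  record Passage (S : Pred (Vertex G) 0ℓ) (s t : Vertex G) : Set where
    field
      {entry exit}           : Vertex G
      {ws₁ ws₃}              : List (Vertex G)
      {es₁ es₃}              : List (Edge G)
      enter                  : Walk′ s entry ws₁ es₁
      leave                  : Walk′ exit t ws₃ es₃
      entry∈S                : S entry
      exit∈S                 : S exit
      entry≢exit             : entry ≢ exit
      enter-meets-S-at-entry : All (λ v → S v → v ≡ entry) (s ∷ ws₁)
      leave-avoids-S         : All (∁ S) ws₃
      enter-simple           : Unique (s ∷ ws₁)
      leave-simple           : Unique ws₃
      enter#leave            : Disjoint (s ∷ ws₁) ws₃

  passage : {S : Pred (Vertex G) 0ℓ} → Decidable S → Walk′ s t ws es → Unique (s ∷ ws) →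
    p ∈ s ∷ ws → q ∈ s ∷ ws → S p → S q → p ≢ q → Passage S s t
  passage {s = s} S? w simple p∈ q∈ Sp Sq p≢q with split-at-first S? w (lose p∈ Sp)
  ... | x , Sx , split {ws₁ = ws₁} enter w₂ refl refl , only-x
    with split-at-last S? w₂ (distinct-witnesses⇒Any-suffix (s ∷ ws₁) only-x p∈ q∈ Sp Sq p≢q)
  ... | y , Sy , split {ws₁ = ms} _ leave refl refl , y∈ms , none-after
    with Unique-++⁻ (s ∷ ws₁) simple
  ... | enter-simple , rest-simple , enter#rest = record
    { enter = enter ; leave = leave ; entry∈S = Sx ; exit∈S = Sy
    ; entry≢exit = λ { refl → enter#rest (end∈ enter , ∈-++⁺ˡ y∈ms) }
    ; enter-meets-S-at-entry = only-x ; leave-avoids-S = none-after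
    ; enter-simple = enter-simple
    ; leave-simple = proj₁ (proj₂ (Unique-++⁻ ms rest-simple))
    ; enter#leave = λ (v∈enter , v∈leave) → enter#rest (v∈enter , ∈-++⁺ʳ ms v∈leave)
    }

  record Arc (x y : Vertex G) (cs : List (Vertex G)) (ces : List (Edge G)) : Set where
    constructor arc
    field
      {vertices} : List (Vertex G)
      {edges}    : List (Edge G)
      walk       : Walk′ x y vertices edges
      simple     : Unique (x ∷ vertices)
      vertices⊆  : vertices ⊆ cs
      edges⊆     : edges ⊆ ces

  Arc-resp-↭ : cs ↭ vs → ces ↭ es → Arc x y cs ces → Arc x y vs es
  Arc-resp-↭ cs↭ ces↭ (arc w simple vs⊆ es⊆) =
    arc w simple (∈-resp-↭ cs↭ ∘ vs⊆) (∈-resp-↭ ces↭ ∘ es⊆)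

  splice : (π : Passage (_∈ cs) s t) (A : Arc (Passage.entry π) (Passage.exit π) cs ces) →
    IsPath G s t (Passage.es₁ π ++ Arc.edges A ++ Passage.es₃ π)
  splice {cs = cs} {s = s} π (arc {vertices = as} w simple@(_ ∷ simple-as) as⊆cs _) =
    _ , walk′⇒walk (enter ++ʷ (w ++ʷ leave)) ,
    ++⁺ enter-simple (++⁺ simple-as leave-simple arc#leave) enter#rest
    where
    open Passage π
    arc#leave : Disjoint as ws₃
    arc#leave (v∈as , v∈ws₃) = lookup leave-avoids-S v∈ws₃ (as⊆cs v∈as)
    enter#rest : Disjoint (s ∷ ws₁) (as ++ ws₃)
    enter#rest (v∈enter , v∈rest) with ∈-++⁻ as v∈rest
    ... | inj₁ v∈as = Unique[x∷xs]⇒x∉xs simple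
        (subst (_∈ as) (lookup enter-meets-S-at-entry v∈enter (as⊆cs v∈as)) v∈as)
    ... | inj₂ v∈ws₃ = enter#leave (v∈enter , v∈ws₃)

  rotate : Walk′ u u cs ces → x ∈ cs → ∃[ cs′ ] ∃[ ces′ ] Walk′ x x cs′ ces′ × cs′ ↭ cs × ces′ ↭ ces
  rotate cycle x∈ with split-at cycle x∈
  ... | split {ws₁ = c₁} {c₂} {d₁} {d₂} w₁ w₂ refl refl = _ , _ , w₂ ++ʷ w₁ , ++-comm c₂ c₁ , ++-comm d₂ d₁

  two-arcs-from : Walk′ x x cs ces → Unique cs → Unique ces → y ∈ cs → x ≢ y →
    Σ[ A₁ ∈ Arc x y cs ces ] Σ[ A₂ ∈ Arc x y cs ces ] Arc.edges A₁ ≢ Arc.edges A₂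
  two-arcs-from {x = x} {y = y} cycle simple-cs simple-ces y∈ x≢y with split-at cycle y∈
  ... | split {ws₁ = r₁} {r₂} {g₁} {g₂} forth back refl refl with reverse-walk′ back
  ... | r₂′ , x∷r₂′↭y∷r₂ , back′ with Unique-++⁻ r₁ simple-cs
  ... | simple-r₁ , simple-r₂ , r₁#r₂ =
    arc forth simple-forth ∈-++⁺ˡ ∈-++⁺ˡ ,
    arc back′ simple-back′ back′⊆ (∈-++⁺ʳ g₁ ∘ ∈-resp-↭ (↭-reverse g₂)) ,
    forth≢back′
    where
    y∈r₁ : y ∈ r₁
    y∈r₁ = end∈tail forth x≢y
    x∈r₂ : x ∈ r₂
    x∈r₂ = end∈tail back (x≢y ∘ sym)
    simple-forth : Unique (x ∷ r₁)
    simple-forth = Unique-∷ (λ x∈r₁ → r₁#r₂ (x∈r₁ , x∈r₂)) simple-r₁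
    simple-back′ : Unique (x ∷ r₂′)
    simple-back′ = Unique-resp-↭ (↭-sym x∷r₂′↭y∷r₂) (Unique-∷ (λ y∈r₂ → r₁#r₂ (y∈r₁ , y∈r₂)) simple-r₂)
    back′⊆ : r₂′ ⊆ r₁ ++ r₂
    back′⊆ v∈ with ∈-resp-↭ x∷r₂′↭y∷r₂ (there v∈)
    ... | here refl  = ∈-++⁺ˡ y∈r₁
    ... | there v∈r₂ = ∈-++⁺ʳ r₁ v∈r₂
    forth≢back′ : g₁ ≢ reverse g₂
    forth≢back′ g₁≡ with edge-exists forth x≢y
    ... | g , g∈g₁ = proj₂ (proj₂ (Unique-++⁻ g₁ simple-ces))
                       (g∈g₁ , ∈-resp-↭ (↭-reverse g₂) (subst (g ∈_) g₁≡ g∈g₁))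

  two-arcs : Walk′ u u cs ces → Unique cs → Unique ces → x ∈ cs → y ∈ cs → x ≢ y →
    Σ[ A₁ ∈ Arc x y cs ces ] Σ[ A₂ ∈ Arc x y cs ces ] Arc.edges A₁ ≢ Arc.edges A₂
  two-arcs cycle simple-cs simple-ces x∈ y∈ x≢y with rotate cycle x∈
  ... | _ , _ , cycle′ , cs′↭cs , ces′↭ces
    with two-arcs-from cycle′ (Unique-resp-↭ (↭-sym cs′↭cs) simple-cs)
           (Unique-resp-↭ (↭-sym ces′↭ces) simple-ces) (∈-resp-↭ (↭-sym cs′↭cs) y∈) x≢y
  ... | A₁ , A₂ , A₁≢A₂ = Arc-resp-↭ cs′↭cs ces′↭ces A₁ , Arc-resp-↭ cs′↭cs ces′↭ces A₂ , A₁≢A₂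

  trace-splice : (T : Subset nE) (es₁ : List (Edge G)) {fs es₃ : List (Edge G)} →
    All (λ g → ¬ g ∈ₛ T) fs → trace G T (es₁ ++ fs ++ es₃) ≡ trace G T es₁ ++ trace G T es₃
  trace-splice T es₁ {fs} {es₃} fs-avoid-T = begin
    trace G T (es₁ ++ fs ++ es₃)
      ≡⟨ filter-++ (_∈? T) es₁ _ ⟩
    trace G T es₁ ++ trace G T (fs ++ es₃)
      ≡⟨ cong (trace G T es₁ ++_) (filter-++ (_∈? T) fs es₃) ⟩
    trace G T es₁ ++ trace G T fs ++ trace G T es₃
      ≡⟨ cong (λ l → trace G T es₁ ++ l ++ trace G T es₃) (filter-none (_∈? T) fs-avoid-T) ⟩
    trace G T es₁ ++ trace G T es₃
      ∎
    where open ≡-Reasoning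

  tracking-set-meets-cycle : (T : Subset nE) → (∀ e → ∃[ es ] IsPath G s t es × e ∈ es) →
    IsTrackingSet G s t T → ∀ {C} → IsCycle G C → ¬ All (λ g → ¬ g ∈ₛ T) C
  tracking-set-meets-cycle {s = s} {t = t} T edges-on-paths tracking
    (u , vs , e , _ , refl , cycle , simple-vs , simple-C) C-avoids-T
    with walk⇒walk′ cycle | edges-on-paths e
  ... | _ , refl , cycle′@(step _ joins-uv rest) | _ , (_ , path , simple-path) , e∈P
    with walk⇒walk′ path
  ... | _ , refl , path′ with simple-walk-edge-ends path′ simple-path e∈P
  ... | a , b , joins-ab , a∈ , b∈ , a≢b =
    splice-both (two-arcs cycle′ simple-vs simple-C entry∈S exit∈S entry≢exit)
    where
    end-on-C : Joins G e p q → p ∈ vs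
    end-on-C = Joins-endpoint∈ joins-uv (end∈ rest) (here refl)
    π : Passage (_∈ vs) s t
    π = passage (λ z → DecMembership._∈?_ _≟ᶠ_ z vs) path′ simple-path a∈ b∈
          (end-on-C joins-ab) (end-on-C (Joins-sym joins-ab)) a≢b
    open Passage π
    avoids-T : (A : Arc entry exit vs _) → All (λ g → ¬ g ∈ₛ T) (Arc.edges A)
    avoids-T A = tabulate (lookup C-avoids-T ∘ Arc.edges⊆ A)
    splice-both : Σ[ A₁ ∈ Arc entry exit vs _ ] Σ[ A₂ ∈ Arc entry exit vs _ ] Arc.edges A₁ ≢ Arc.edges A₂ → ⊥
    splice-both (A₁ , A₂ , A₁≢A₂) =
      tracking _ _ (splice π A₁) (splice π A₂)
        (λ P₁≡P₂ → A₁≢A₂ (++-cancelʳ es₃ _ _ (++-cancelˡ es₁ _ _ P₁≡P₂)))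
        (trans (trace-splice T es₁ (avoids-T A₁)) (sym (trace-splice T es₁ (avoids-T A₂))))

lemma12 : (G : Graph) (s t : Vertex G) (T : Subset (Graph.nE G)) →
    AllOnPaths G s t → IsTrackingSet G s t T →
    ∀ (C : List (Edge G)) → IsCycle G C → ∃[ e ] (e ∈ C × e ∈ₛ T)
lemma12 G s t T (_ , edges-on-paths) tracking C cycle with any? (_∈? T) C
... | yes hit = find hit
... | no miss = ⊥-elim (tracking-set-meets-cycle G T edges-on-paths tracking cycle (¬Any⇒All¬ C miss))
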